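{- Let $k$ be a positive integer, $G=C_{3k+2}$, and let $G_1,G_2$ be disjoint copies of $G$ whose vertices are each labeled $1,\dots,3k+2$ cyclically. Let $f:V(G_1)\to V(G_2)$ be a bijection such that $d_{G_2}(f(x),f(y))\equiv 1\pmod 3$ whenever $d_{G_1}(x,y)\equiv 1\pmod 3$. If $f(1)=1$, then $C(C_{3k+2},f)\cong C_{3k+2}\times K_2$.
   Context: For disjoint copies $G_1,G_2$ of a graph $G$ and a function $f:V(G_1)\to V(G_2)$, the functigraph $C(G,f)$ has vertex set $V(G_1)\cup V(G_2)$ and edge set $E(G_1)\cup E(G_2)\cup\{uv : u\in V(G_1), v\in V(G_2), v=f(u)\}$. $d_{G_i}(x,y)$ is the distance in the cycle $G_i$; $C_{3k+2}\times K_2$ is the Cartesian product (prism). -}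

module Defs where

open import Level using (0ℓ)
open import Data.Nat using (ℕ; suc; _+_; _*_; _∸_; _⊓_; _%_)
open import Data.Fin using (Fin; toℕ)
open import Data.Sum using (_⊎_; inj₁; inj₂)
open import Data.Product using (Σ)
open import Data.Empty using (⊥)
open import Relation.Binary.PropositionalEquality using (_≡_)
open import Function.Bundles using (_↔_; _⇔_; Inverse)

Graph : Set → Set₁
Graph V = V → V → Set

absDiff : ℕ → ℕ → ℕ
absDiff a b = (a ∸ b) + (b ∸ a)

-- Distance in the cycle C_n whose vertices 1..n are represented by Fin n
-- (label i ↦ index i-1), with i adjacent to i±1 (mod n).
cycDist : (n : ℕ) → Fin n → Fin n → ℕ
cycDist n x y = absDiff (toℕ x) (toℕ y) ⊓ (n ∸ absDiff (toℕ x) (toℕ y))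

Cycle : (n : ℕ) → Graph (Fin n)
Cycle n x y = cycDist n x y ≡ 1

Functigraph : {V : Set} → Graph V → (V → V) → Graph (V ⊎ V)
Functigraph G f (inj₁ u) (inj₁ v) = G u v
Functigraph G f (inj₂ u) (inj₂ v) = G u v
Functigraph G f (inj₁ u) (inj₂ v) = v ≡ f u
Functigraph G f (inj₂ v) (inj₁ u) = v ≡ f u

-- Cartesian product G × K₂ (vertex set V × {1,2} represented as V ⊎ V).
PrismOf : {V : Set} → Graph V → Graph (V ⊎ V)
PrismOf G (inj₁ u) (inj₁ v) = G u v
PrismOf G (inj₂ u) (inj₂ v) = G u v
PrismOf G (inj₁ u) (inj₂ v) = u ≡ v
PrismOf G (inj₂ u) (inj₁ v) = u ≡ v

_≅_ : {V W : Set} → Graph V → Graph W → Set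
_≅_ {V} {W} G H =
  Σ (V ↔ W) λ φ → ∀ a b → G a b ⇔ H (Inverse.to φ a) (Inverse.to φ b)

-- Identify the vertices of C_N, N = 3k + 2, with ℤ/N and write x ~ y when the cycle distance of
-- x and y is ≡ 1 (mod 3). As N ≡ 2 (mod 3), this holds exactly when y − x ∈ {1, 4, …, 3k + 1}.
-- For x ≠ y, at most one vertex r satisfies x ~ r but not y ~ r precisely when y = x ± 3. A
-- bijection preserving ~ also reflects it (by counting), so it preserves this characterisation
-- and hence the relation y = x ± 3. Since 3 generates ℤ/N and f 0 = 0, f is then determined by
-- f 3 ∈ {3, −3}: it is the identity or the reflection x ↦ −x. Both are involutive automorphisms
-- h of C_N, and for those (u, v) ↦ (u, h v) is an isomorphism C(C_N, h) ≅ C_N × K₂.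

module Submission where

open import Defs
open import Level using (0ℓ)
open import Data.Nat using (ℕ; zero; suc; _+_; _*_; _∸_; _⊓_; _%_; _≤_; _<_; _<?_; NonZero; z≤n; s≤s)
open import Data.Nat.Properties
open import Data.Nat.DivMod
open import Data.Nat.Tactic.RingSolver using (solve-∀)
open import Data.Fin using (Fin; zero; toℕ; fromℕ<)
open import Data.Fin.Properties using (toℕ-fromℕ<; toℕ<n; toℕ-injective) renaming (_≟_ to _≟ᶠ_)
open import Data.Sum using (_⊎_; inj₁; inj₂; [_,_])
open import Data.Product as Product using (_×_; _,_; proj₁; proj₂; ∃; uncurry)
open import Data.Product.Properties using (≡-dec)
open import Data.Empty using (⊥-elim)
open import Data.List using (List; []; _∷_; length; map; filter; cartesianProduct; allFin)
open import Data.List.Properties using (filter-notAll; length-map)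
open import Data.List.Membership.Propositional using (_∈_)
open import Data.List.Membership.Propositional.Properties
  using (∈-filter⁺; ∈-filter⁻; ∈-map⁻; ∈-cartesianProduct⁺; ∈-allFin)
open import Data.List.Relation.Unary.All using (lookup; tabulate)
open import Data.List.Relation.Unary.Any as Any using (here; there)
open import Data.List.Relation.Unary.AllPairs using (_∷_)
open import Data.List.Relation.Unary.Unique.Propositional using (Unique)
import Data.List.Relation.Unary.Unique.Propositional.Properties as Unique
open import Function using (_∘′_)
open import Function.Bundles using (_⇔_; mk⇔; Equivalence; mk↔ₛ′)
open import Function.Definitions using (Injective; Surjective; Bijective)
open import Relation.Nullary using (¬_; ¬?; Dec; yes; no; contradiction)
import Relation.Nullary.Decidable as Dec
open import Relation.Unary using (Pred; Decidable)
open import Relation.Binary.Core using (Rel)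
import Relation.Binary.Definitions as B
open import Relation.Binary.Definitions using (DecidableEquality)
open import Relation.Binary.PropositionalEquality
  using (_≡_; _≢_; refl; sym; trans; cong; cong₂; subst; subst₂; module ≡-Reasoning)
open ≡-Reasoning

module _ {A : Set} (_≟A_ : DecidableEquality A) where

  length-mono-⊆ : ∀ {xs ys : List A} → Unique xs → (∀ {z} → z ∈ xs → z ∈ ys) →
                  length xs ≤ length ys
  length-mono-⊆ {[]}     _              _   = z≤n
  length-mono-⊆ {x ∷ xs} {ys} (x∉xs ∷ u) xs⊆ys =
    <-≤-trans (s≤s (length-mono-⊆ u xs⊆ys-x)) (filter-notAll (λ y → ¬? (x ≟A y)) ys
      (Any.map (λ x≡y x≢y → x≢y x≡y) (xs⊆ys (here refl))))
    where
    xs⊆ys-x : ∀ {z} → z ∈ xs → z ∈ filter (λ y → ¬? (x ≟A y)) ys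
    xs⊆ys-x z∈xs = ∈-filter⁺ _ (xs⊆ys (there z∈xs)) (λ x≡z → lookup x∉xs z∈xs x≡z)

  -- g maps the finite set {a | P a} injectively into itself, hence onto itself.
  injective-preserving⇒reflecting :
    (xs : List A) → Unique xs → (∀ a → a ∈ xs) →
    {P : Pred A 0ℓ} → Decidable P → {g : A → A} → Injective _≡_ _≡_ g →
    (∀ {a} → P a → P (g a)) → ∀ {a} → P (g a) → P a
  injective-preserving⇒reflecting xs unique complete {P} P? {g} g-inj preserves {a} Pga with P? a
  ... | yes Pa = Pa
  ... | no ¬Pa = contradiction (subst (λ m → suc m ≤ length L) (length-map g L) |ga∷gL|≤|L|) (<-irrefl refl)
    where
    L = filter P? xs
    ga∉gL : ∀ {z} → z ∈ map g L → g a ≢ z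
    ga∉gL z∈gL ga≡z with ∈-map⁻ g z∈gL
    ... | b , b∈L , refl = ¬Pa (subst P (sym (g-inj ga≡z)) (proj₂ (∈-filter⁻ P? {xs = xs} b∈L)))
    ⊆L : ∀ {z} → z ∈ g a ∷ map g L → z ∈ L
    ⊆L (here refl)  = ∈-filter⁺ P? (complete _) Pga
    ⊆L (there z∈gL) with ∈-map⁻ g z∈gL
    ... | b , b∈L , refl = ∈-filter⁺ P? (complete _) (preserves (proj₂ (∈-filter⁻ P? {xs = xs} b∈L)))
    |ga∷gL|≤|L| : length (g a ∷ map g L) ≤ length L
    |ga∷gL|≤|L| = length-mono-⊆ (tabulate ga∉gL ∷ Unique.map⁺ g-inj (Unique.filter⁺ P? unique)) ⊆L

Fin-injective-preserving⇒reflecting :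
  ∀ {n} {_∼_ : Rel (Fin n) 0ℓ} → B.Decidable _∼_ → {f : Fin n → Fin n} →
  Injective _≡_ _≡_ f → (∀ {x y} → x ∼ y → f x ∼ f y) → ∀ {x y} → f x ∼ f y → x ∼ y
Fin-injective-preserving⇒reflecting {n} {_∼_} _∼?_ {f} f-inj preserves {x} {y} =
  injective-preserving⇒reflecting (≡-dec _≟ᶠ_ _≟ᶠ_) pairs
    (Unique.cartesianProduct⁺ (Unique.allFin⁺ n) (Unique.allFin⁺ n))
    (λ (u , v) → ∈-cartesianProduct⁺ (∈-allFin u) (∈-allFin v))
    (uncurry _∼?_) f×f-inj preserves {x , y}
  where
  pairs = cartesianProduct (allFin n) (allFin n)
  f×f-inj : Injective _≡_ _≡_ (Product.map f f)
  f×f-inj eq = cong₂ _,_ (f-inj (cong proj₁ eq)) (f-inj (cong proj₂ eq))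

%3-view : ∀ a → a % 3 ≡ 0 ⊎ a % 3 ≡ 1 ⊎ a % 3 ≡ 2
%3-view a with a % 3 | m%n<n a 3
... | 0 | _ = inj₁ refl
... | 1 | _ = inj₂ (inj₁ refl)
... | 2 | _ = inj₂ (inj₂ refl)
... | suc (suc (suc _)) | s≤s (s≤s (s≤s ()))

%3-+ : ∀ {a b c i j} → a + b ≡ c → a % 3 ≡ i → b % 3 ≡ j → c % 3 ≡ (i + j) % 3
%3-+ {a} {b} refl refl refl = %-distribˡ-+ a b 3

%3≡1-complement : ∀ {a b c} → a + b ≡ c → c % 3 ≡ 2 → a % 3 ≡ 1 → b % 3 ≡ 1
%3≡1-complement {a} {b} eq c≡2 a≡1 with %3-view b
... | inj₁ b≡0        = contradiction (trans (sym c≡2) (%3-+ {a} {b} eq a≡1 b≡0)) λ ()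
... | inj₂ (inj₁ b≡1) = b≡1
... | inj₂ (inj₂ b≡2) = contradiction (trans (sym c≡2) (%3-+ {a} {b} eq a≡1 b≡2)) λ ()

⊓-∸-%3≡1 : ∀ {a n} → a ≤ n → n % 3 ≡ 2 → (a ⊓ (n ∸ a)) % 3 ≡ 1 ⇔ a % 3 ≡ 1
⊓-∸-%3≡1 {a} {n} a≤n n≡2 with ≤-total a (n ∸ a)
... | inj₁ a≤n∸a = mk⇔ (subst (λ v → v % 3 ≡ 1) (m≤n⇒m⊓n≡m a≤n∸a))
                        (subst (λ v → v % 3 ≡ 1) (sym (m≤n⇒m⊓n≡m a≤n∸a)))
... | inj₂ n∸a≤a = mk⇔
  (λ h → %3≡1-complement {n ∸ a} (trans (+-comm (n ∸ a) a) (m+[n∸m]≡n a≤n)) n≡2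
           (subst (λ v → v % 3 ≡ 1) (m≥n⇒m⊓n≡n n∸a≤a) h))
  (λ h → subst (λ v → v % 3 ≡ 1) (sym (m≥n⇒m⊓n≡n n∸a≤a)) (%3≡1-complement {a} (m+[n∸m]≡n a≤n) n≡2 h))

≢-residue : ∀ {a i j} → a % 3 ≡ i → i ≢ j → a % 3 ≢ j
≢-residue a≡i i≢j a≡j = i≢j (trans (sym a≡i) a≡j)

%3-+-cancel : ∀ a j → (a + j) % 3 ≡ a % 3 → j % 3 ≡ 0
%3-+-cancel a j eq = residues (a % 3) (j % 3) (m%n<n a 3) (m%n<n j 3)
  (trans (sym (%-distribˡ-+ a j 3)) (trans eq (sym (m%n%n≡m%n a 3))))
  where
  residues : ∀ i r → i < 3 → r < 3 → (i + r) % 3 ≡ i % 3 → r ≡ 0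
  residues _ 0 _ _ _ = refl
  residues 0 1 _ _ ()
  residues 1 1 _ _ ()
  residues 2 1 _ _ ()
  residues 0 2 _ _ ()
  residues 1 2 _ _ ()
  residues 2 2 _ _ ()
  residues (suc (suc (suc _))) _ (s≤s (s≤s (s≤s ()))) _ _
  residues _ (suc (suc (suc _))) _ (s≤s (s≤s (s≤s ()))) _

+3≤-of-≡%3 : ∀ {a b} → a < b → a % 3 ≡ b % 3 → a + 3 ≤ b
+3≤-of-≡%3 {a} a<b a≡b with m≤n⇒∃[o]m+o≡n a<b
... | o , refl = gap o (%3-+-cancel a (suc o) (trans (cong (_% 3) (+-suc a o)) (sym a≡b)))
  where
  gap : ∀ o → suc o % 3 ≡ 0 → a + 3 ≤ suc a + o
  gap (suc (suc o)) _ =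
    subst (_≤ suc a + suc (suc o)) (sym (+-suc a 2)) (s≤s (+-monoʳ-≤ a (s≤s (s≤s z≤n))))

+6≤-of-≡%3 : ∀ {a b} → a < b → a % 3 ≡ b % 3 → a + 3 ≢ b → a + 6 ≤ b
+6≤-of-≡%3 {a} {b} a<b a≡b a+3≢b =
  subst (_≤ b) (+-assoc a 3 3)
    (+3≤-of-≡%3 (≤∧≢⇒< (+3≤-of-≡%3 a<b a≡b) a+3≢b) (trans ([m+n]%n≡m%n a 3) a≡b))

6%[2+3k]≢0 : ∀ k → 1 ≤ k → 6 % (2 + 3 * k) ≢ 0
6%[2+3k]≢0 1 _ ()
6%[2+3k]≢0 (suc (suc k)) _ 6%N≡0 = contradiction (trans (sym (m<n⇒m%n≡m 6<N)) 6%N≡0) λ ()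
  where
  6<N : 6 < 2 + 3 * suc (suc k)
  6<N = ≤-trans (n≤1+n 7) (+-monoʳ-≤ 2 (*-monoʳ-≤ 3 {2} {suc (suc k)} (s≤s (s≤s z≤n))))

3[1+k]x≡x+x[2+3k] : ∀ k x → 3 * (suc k * x) ≡ x + x * (2 + 3 * k)
3[1+k]x≡x+x[2+3k] = solve-∀

[m%d+n]%d≡[m+n]%d : ∀ m n d .{{_ : NonZero d}} → (m % d + n) % d ≡ (m + n) % d
[m%d+n]%d≡[m+n]%d m n d = begin
  (m % d + n) % d         ≡⟨ %-distribˡ-+ (m % d) n d ⟩
  (m % d % d + n % d) % d ≡⟨ cong (λ v → (v + n % d) % d) (m%n%n≡m%n m d) ⟩
  (m % d + n % d) % d     ≡⟨ %-distribˡ-+ m n d ⟨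
  (m + n) % d             ∎

[m+n%d]%d≡[m+n]%d : ∀ m n d .{{_ : NonZero d}} → (m + n % d) % d ≡ (m + n) % d
[m+n%d]%d≡[m+n]%d m n d = begin
  (m + n % d) % d ≡⟨ cong (_% d) (+-comm m (n % d)) ⟩
  (n % d + m) % d ≡⟨ [m%d+n]%d≡[m+n]%d n m d ⟩
  (n + m) % d     ≡⟨ cong (_% d) (+-comm n m) ⟩
  (m + n) % d     ∎

absDiff-comm : ∀ m n → absDiff m n ≡ absDiff n m
absDiff-comm m n = +-comm (m ∸ n) (n ∸ m)

absDiff-+ : ∀ m n → absDiff m (m + n) ≡ n
absDiff-+ m n = cong₂ _+_ (m≤n⇒m∸n≡0 (m≤m+n m n)) (m+n∸m≡n m n)

-- ℤ/(suc m) on Fin (suc m): x ⊕ a adds a natural number, neg negates, and offset x y is the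
-- representative of y − x in [0, suc m).
module Cyclic (m : ℕ) where

  private
    n : ℕ
    n = suc m

  infixl 6 _⊕_
  _⊕_ : Fin n → ℕ → Fin n
  x ⊕ a = fromℕ< (m%n<n (toℕ x + a) n)

  toℕ-⊕ : ∀ x a → toℕ (x ⊕ a) ≡ (toℕ x + a) % n
  toℕ-⊕ x a = toℕ-fromℕ< (m%n<n (toℕ x + a) n)

  ⊕-identityʳ : ∀ x → x ⊕ 0 ≡ x
  ⊕-identityʳ x = toℕ-injective (begin
    toℕ (x ⊕ 0)     ≡⟨ toℕ-⊕ x 0 ⟩
    (toℕ x + 0) % n ≡⟨ cong (_% n) (+-identityʳ (toℕ x)) ⟩
    toℕ x % n       ≡⟨ m<n⇒m%n≡m (toℕ<n x) ⟩
    toℕ x           ∎)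

  ⊕-assoc : ∀ x a b → x ⊕ a ⊕ b ≡ x ⊕ (a + b)
  ⊕-assoc x a b = toℕ-injective (begin
    toℕ (x ⊕ a ⊕ b)             ≡⟨ toℕ-⊕ (x ⊕ a) b ⟩
    (toℕ (x ⊕ a) + b) % n       ≡⟨ cong (λ v → (v + b) % n) (toℕ-⊕ x a) ⟩
    ((toℕ x + a) % n + b) % n   ≡⟨ [m%d+n]%d≡[m+n]%d (toℕ x + a) b n ⟩
    (toℕ x + a + b) % n         ≡⟨ cong (_% n) (+-assoc (toℕ x) a b) ⟩
    (toℕ x + (a + b)) % n       ≡⟨ toℕ-⊕ x (a + b) ⟨
    toℕ (x ⊕ (a + b))           ∎)

  ⊕-cong : ∀ x {a b} → a % n ≡ b % n → x ⊕ a ≡ x ⊕ b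
  ⊕-cong x {a} {b} a≡b = toℕ-injective (begin
    toℕ (x ⊕ a)           ≡⟨ toℕ-⊕ x a ⟩
    (toℕ x + a) % n       ≡⟨ [m+n%d]%d≡[m+n]%d (toℕ x) a n ⟨
    (toℕ x + a % n) % n   ≡⟨ cong (λ v → (toℕ x + v) % n) a≡b ⟩
    (toℕ x + b % n) % n   ≡⟨ [m+n%d]%d≡[m+n]%d (toℕ x) b n ⟩
    (toℕ x + b) % n       ≡⟨ toℕ-⊕ x b ⟨
    toℕ (x ⊕ b)           ∎)

  ⊕-comm : ∀ x y → x ⊕ toℕ y ≡ y ⊕ toℕ x
  ⊕-comm x y = toℕ-injective (begin
    toℕ (x ⊕ toℕ y)       ≡⟨ toℕ-⊕ x (toℕ y) ⟩
    (toℕ x + toℕ y) % n   ≡⟨ cong (_% n) (+-comm (toℕ x) (toℕ y)) ⟩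
    (toℕ y + toℕ x) % n   ≡⟨ toℕ-⊕ y (toℕ x) ⟨
    toℕ (y ⊕ toℕ x)       ∎)

  zero-⊕ : ∀ x → zero ⊕ toℕ x ≡ x
  zero-⊕ x = trans (⊕-comm zero x) (⊕-identityʳ x)

  offset : Fin n → Fin n → ℕ
  offset x y = (toℕ y + (n ∸ toℕ x)) % n

  offset<n : ∀ x y → offset x y < n
  offset<n x y = m%n<n (toℕ y + (n ∸ toℕ x)) n

  ⊕-offset : ∀ x y → x ⊕ offset x y ≡ y
  ⊕-offset x y = toℕ-injective (begin
    toℕ (x ⊕ offset x y)             ≡⟨ toℕ-⊕ x (offset x y) ⟩
    (toℕ x + offset x y) % n         ≡⟨ [m+n%d]%d≡[m+n]%d (toℕ x) _ n ⟩
    (toℕ x + (toℕ y + (n ∸ toℕ x))) % n ≡⟨ cong (_% n) (x+[y+[n∸x]]≡y+n (toℕ x) (toℕ y) (<⇒≤ (toℕ<n x))) ⟩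
    (toℕ y + n) % n                  ≡⟨ [m+n]%n≡m%n (toℕ y) n ⟩
    toℕ y % n                        ≡⟨ m<n⇒m%n≡m (toℕ<n y) ⟩
    toℕ y                            ∎)
    where
    x+[y+[n∸x]]≡y+n : ∀ x y → x ≤ n → x + (y + (n ∸ x)) ≡ y + n
    x+[y+[n∸x]]≡y+n x y x≤n = begin
      x + (y + (n ∸ x)) ≡⟨ cong (x +_) (+-comm y (n ∸ x)) ⟩
      x + ((n ∸ x) + y) ≡⟨ +-assoc x (n ∸ x) y ⟨
      x + (n ∸ x) + y   ≡⟨ cong (_+ y) (m+[n∸m]≡n x≤n) ⟩
      n + y             ≡⟨ +-comm n y ⟩
      y + n             ∎

  offset-⊕ : ∀ x a → offset x (x ⊕ a) ≡ a % n
  offset-⊕ x a = begin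
    (toℕ (x ⊕ a) + (n ∸ toℕ x)) % n       ≡⟨ cong (λ v → (v + (n ∸ toℕ x)) % n) (toℕ-⊕ x a) ⟩
    ((toℕ x + a) % n + (n ∸ toℕ x)) % n   ≡⟨ [m%d+n]%d≡[m+n]%d (toℕ x + a) (n ∸ toℕ x) n ⟩
    (toℕ x + a + (n ∸ toℕ x)) % n         ≡⟨ cong (_% n) (x+a+[n∸x]≡a+n (toℕ x) (<⇒≤ (toℕ<n x))) ⟩
    (a + n) % n                           ≡⟨ [m+n]%n≡m%n a n ⟩
    a % n                                 ∎
    where
    x+a+[n∸x]≡a+n : ∀ x → x ≤ n → x + a + (n ∸ x) ≡ a + n
    x+a+[n∸x]≡a+n x x≤n = begin
      x + a + (n ∸ x)   ≡⟨ cong (_+ (n ∸ x)) (+-comm x a) ⟩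
      a + x + (n ∸ x)   ≡⟨ +-assoc a x (n ∸ x) ⟩
      a + (x + (n ∸ x)) ≡⟨ cong (a +_) (m+[n∸m]≡n x≤n) ⟩
      a + n             ∎

  ⊕-cancelˡ : ∀ x {a b} → x ⊕ a ≡ x ⊕ b → a % n ≡ b % n
  ⊕-cancelˡ x {a} {b} eq = trans (sym (offset-⊕ x a)) (trans (cong (offset x) eq) (offset-⊕ x b))

  ⊕-≢ : ∀ x {a b} → a < n → b < n → a ≢ b → x ⊕ a ≢ x ⊕ b
  ⊕-≢ x {a} {b} a<n b<n a≢b eq =
    a≢b (trans (sym (m<n⇒m%n≡m a<n)) (trans (⊕-cancelˡ x eq) (m<n⇒m%n≡m b<n)))

  ⊕-cancelʳ : ∀ {x y a} → a ≤ n → x ⊕ a ≡ y ⊕ a → x ≡ y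
  ⊕-cancelʳ {x} {y} {a} a≤n eq = trans (sym (⊕-⊖ x)) (trans (cong (_⊕ (n ∸ a)) eq) (⊕-⊖ y))
    where
    ⊕-⊖ : ∀ z → z ⊕ a ⊕ (n ∸ a) ≡ z
    ⊕-⊖ z = begin
      z ⊕ a ⊕ (n ∸ a)   ≡⟨ ⊕-assoc z a (n ∸ a) ⟩
      z ⊕ (a + (n ∸ a)) ≡⟨ ⊕-cong z (trans (cong (_% n) (m+[n∸m]≡n a≤n)) (n%n≡0 n)) ⟩
      z ⊕ 0             ≡⟨ ⊕-identityʳ z ⟩
      z                 ∎

  neg : Fin n → Fin n
  neg x = zero ⊕ (n ∸ toℕ x)

  ⊕-neg : ∀ x → x ⊕ toℕ (neg x) ≡ zero
  ⊕-neg x = begin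
    x ⊕ toℕ (neg x)   ≡⟨ ⊕-cong x (trans (cong (_% n) (toℕ-⊕ zero (n ∸ toℕ x)))
                                         (m%n%n≡m%n (n ∸ toℕ x) n)) ⟩
    x ⊕ (n ∸ toℕ x)   ≡⟨ toℕ-injective (trans (toℕ-⊕ x (n ∸ toℕ x))
                           (trans (cong (_% n) (m+[n∸m]≡n (<⇒≤ (toℕ<n x)))) (n%n≡0 n))) ⟩
    zero              ∎

  neg-unique : ∀ x {y} → x ⊕ toℕ y ≡ zero → y ≡ neg x
  neg-unique x {y} eq = toℕ-injective (begin
    toℕ y             ≡⟨ m<n⇒m%n≡m (toℕ<n y) ⟨
    toℕ y % n         ≡⟨ ⊕-cancelˡ x (trans eq (sym (⊕-neg x))) ⟩
    toℕ (neg x) % n   ≡⟨ m<n⇒m%n≡m (toℕ<n (neg x)) ⟩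
    toℕ (neg x)       ∎)

  neg-involutive : ∀ x → neg (neg x) ≡ x
  neg-involutive x = sym (neg-unique (neg x) (trans (⊕-comm (neg x) x) (⊕-neg x)))

  neg-injective : ∀ {x y} → neg x ≡ neg y → x ≡ y
  neg-injective {x} {y} eq = trans (sym (neg-involutive x)) (trans (cong neg eq) (neg-involutive y))

  neg-zero : neg zero ≡ zero
  neg-zero = sym (neg-unique zero (⊕-identityʳ zero))

  neg-⊕ : ∀ x a → neg (x ⊕ a) ⊕ a ≡ neg x
  neg-⊕ x a = neg-unique x (begin
    x ⊕ toℕ (y ⊕ a)       ≡⟨ ⊕-cong x (trans (cong (_% n) (toℕ-⊕ y a)) (m%n%n≡m%n (toℕ y + a) n)) ⟩
    x ⊕ (toℕ y + a)       ≡⟨ cong (x ⊕_) (+-comm (toℕ y) a) ⟩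
    x ⊕ (a + toℕ y)       ≡⟨ ⊕-assoc x a (toℕ y) ⟨
    x ⊕ a ⊕ toℕ y         ≡⟨ ⊕-neg (x ⊕ a) ⟩
    zero                  ∎)
    where y = neg (x ⊕ a)

  cycDist-sym : ∀ x y → cycDist n x y ≡ cycDist n y x
  cycDist-sym x y = cong (λ d → d ⊓ (n ∸ d)) (absDiff-comm (toℕ x) (toℕ y))

  absDiff-⊕ : ∀ x {a} → a < n →
              absDiff (toℕ x) (toℕ (x ⊕ a)) ≡ a ⊎ absDiff (toℕ x) (toℕ (x ⊕ a)) ≡ n ∸ a
  absDiff-⊕ x {a} a<n with toℕ x + a <? n
  ... | yes x+a<n = inj₁ (begin
    absDiff (toℕ x) (toℕ (x ⊕ a)) ≡⟨ cong (absDiff (toℕ x)) (trans (toℕ-⊕ x a) (m<n⇒m%n≡m x+a<n)) ⟩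
    absDiff (toℕ x) (toℕ x + a)   ≡⟨ absDiff-+ (toℕ x) a ⟩
    a                             ∎)
  ... | no x+a≮n = inj₂ (begin
    absDiff (toℕ x) (toℕ (x ⊕ a)) ≡⟨ cong₂ absDiff x≡w+[n∸a] toℕ[x⊕a]≡w ⟩
    absDiff (w + (n ∸ a)) w       ≡⟨ absDiff-comm (w + (n ∸ a)) w ⟩
    absDiff w (w + (n ∸ a))       ≡⟨ absDiff-+ w (n ∸ a) ⟩
    n ∸ a                         ∎)
    where
    n≤x+a : n ≤ toℕ x + a
    n≤x+a = ≮⇒≥ x+a≮n
    w : ℕ
    w = toℕ x + a ∸ n
    toℕ[x⊕a]≡w : toℕ (x ⊕ a) ≡ w
    toℕ[x⊕a]≡w = begin
      toℕ (x ⊕ a)     ≡⟨ toℕ-⊕ x a ⟩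
      (toℕ x + a) % n ≡⟨ m≤n⇒[n∸m]%m≡n%m n≤x+a ⟨
      w % n           ≡⟨ m<n⇒m%n≡m (m<n+o⇒m∸n<o (toℕ x + a) n (+-mono-< (toℕ<n x) a<n)) ⟩
      w               ∎
    x≡w+[n∸a] : toℕ x ≡ w + (n ∸ a)
    x≡w+[n∸a] = +-cancelʳ-≡ _ _ _ (begin
      toℕ x + a             ≡⟨ m∸n+n≡m n≤x+a ⟨
      w + n                 ≡⟨ cong (w +_) (m∸n+n≡m (<⇒≤ a<n)) ⟨
      w + ((n ∸ a) + a)     ≡⟨ +-assoc w (n ∸ a) a ⟨
      w + (n ∸ a) + a       ∎)

  cycDist-⊕ : ∀ x {a} → a < n → cycDist n x (x ⊕ a) ≡ a ⊓ (n ∸ a)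
  cycDist-⊕ x {a} a<n with absDiff-⊕ x a<n
  ... | inj₁ d≡a   = cong (λ d → d ⊓ (n ∸ d)) d≡a
  ... | inj₂ d≡n∸a = begin
    cycDist n x (x ⊕ a)       ≡⟨ cong (λ d → d ⊓ (n ∸ d)) d≡n∸a ⟩
    (n ∸ a) ⊓ (n ∸ (n ∸ a))   ≡⟨ cong ((n ∸ a) ⊓_) (m∸[m∸n]≡n (<⇒≤ a<n)) ⟩
    (n ∸ a) ⊓ a               ≡⟨ ⊓-comm (n ∸ a) a ⟩
    a ⊓ (n ∸ a)               ∎

  cycDist-neg : ∀ x y → cycDist n (neg x) (neg y) ≡ cycDist n x y
  cycDist-neg x y = begin
    cycDist n (neg x) (neg y)        ≡⟨ cycDist-sym (neg x) (neg y) ⟩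
    cycDist n (neg y) (neg x)        ≡⟨ cong (cycDist n (neg y)) neg-x≡neg-y⊕c ⟩
    cycDist n (neg y) (neg y ⊕ c)    ≡⟨ cycDist-⊕ (neg y) (offset<n x y) ⟩
    c ⊓ (n ∸ c)                      ≡⟨ cycDist-⊕ x (offset<n x y) ⟨
    cycDist n x (x ⊕ c)              ≡⟨ cong (cycDist n x) (⊕-offset x y) ⟩
    cycDist n x y                    ∎
    where
    c = offset x y
    neg-x≡neg-y⊕c : neg x ≡ neg y ⊕ c
    neg-x≡neg-y⊕c = trans (sym (neg-⊕ x c)) (cong (λ z → neg z ⊕ c) (⊕-offset x y))

involutive-automorphism⇒Functigraph≅PrismOf :
  ∀ {V : Set} (G : Graph V) {h : V → V} → (∀ v → h (h v) ≡ v) → (∀ u v → G u v → G (h u) (h v)) →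
  ∀ {f : V → V} → (∀ v → f v ≡ h v) → Functigraph G f ≅ PrismOf G
involutive-automorphism⇒Functigraph≅PrismOf G {h} h-inv h-hom {f} f≗h = mk↔ₛ′ ψ ψ ψ-inv ψ-inv , edges
  where
  ψ : _ ⊎ _ → _ ⊎ _
  ψ (inj₁ u) = inj₁ u
  ψ (inj₂ v) = inj₂ (h v)
  ψ-inv : ∀ z → ψ (ψ z) ≡ z
  ψ-inv (inj₁ u) = refl
  ψ-inv (inj₂ v) = cong inj₂ (h-inv v)
  edges : ∀ a b → Functigraph G f a b ⇔ PrismOf G (ψ a) (ψ b)
  edges (inj₁ u) (inj₁ v) = mk⇔ (λ adj → adj) (λ adj → adj)
  edges (inj₂ u) (inj₂ v) = mk⇔ (h-hom u v) (λ adj → subst₂ G (h-inv u) (h-inv v) (h-hom (h u) (h v) adj))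
  edges (inj₁ u) (inj₂ v) = mk⇔ (λ v≡fu → trans (sym (h-inv u)) (cong h (sym (trans v≡fu (f≗h u)))))
                                (λ u≡hv → trans (sym (h-inv v)) (trans (cong h (sym u≡hv)) (sym (f≗h u))))
  edges (inj₂ v) (inj₁ u) = mk⇔ (λ v≡fu → trans (cong h (trans v≡fu (f≗h u))) (h-inv u))
                                (λ hv≡u → trans (sym (h-inv v)) (trans (cong h hv≡u) (sym (f≗h u))))

Subsingleton : {A : Set} → (A → Set) → Set
Subsingleton P = ∀ {r s} → P r → P s → r ≡ s

module Prism (k : ℕ) where

  N : ℕ
  N = 2 + 3 * k

  open Cyclic (suc (3 * k)) public

  N%3≡2 : N % 3 ≡ 2
  N%3≡2 = trans (cong (λ v → (2 + v) % 3) (*-comm 3 k)) ([m+kn]%n≡m%n 2 k 3)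

  5≤N : 1 ≤ k → 5 ≤ N
  5≤N 1≤k = +-monoʳ-≤ 2 (*-monoʳ-≤ 3 1≤k)

  3<N : 1 ≤ k → 3 < N
  3<N 1≤k = ≤-trans (n≤1+n 4) (5≤N 1≤k)

  -- A record rather than a bare equation, so that x and y can be inferred from a proof.
  infix 4 _~_
  record _~_ (x y : Fin N) : Set where
    constructor related
    field cycDist%3≡1 : cycDist N x y % 3 ≡ 1

  ~-⊕ : ∀ x {a} → a < N → x ~ x ⊕ a ⇔ a % 3 ≡ 1
  ~-⊕ x {a} a<N = mk⇔ (to ∘′ _~_.cycDist%3≡1) (related ∘′ from)
    where
    open Equivalence (subst (λ d → d % 3 ≡ 1 ⇔ a % 3 ≡ 1) (sym (cycDist-⊕ x a<N))
                            (⊓-∸-%3≡1 (<⇒≤ a<N) N%3≡2))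

  ~-offset : ∀ {x y} → x ~ y → offset x y % 3 ≡ 1
  ~-offset {x} {y} x~y = Equivalence.to (~-⊕ x (offset<n x y)) (subst (x ~_) (sym (⊕-offset x y)) x~y)

  neg-~ : ∀ {x y} → x ~ y → neg x ~ neg y
  neg-~ {x} {y} (related d) = related (subst (λ d → d % 3 ≡ 1) (sym (cycDist-neg x y)) d)

  neg-≁ : ∀ {x y} → ¬ x ~ y → ¬ neg x ~ neg y
  neg-≁ {x} {y} x≁y (related d) = x≁y (related (subst (λ d → d % 3 ≡ 1) (cycDist-neg x y) d))

  record Exclusive (x y r : Fin N) : Set where
    constructor exclusive
    field
      near : x ~ r
      far  : ¬ y ~ r

  ThreeApart : Fin N → Fin N → Set
  ThreeApart x y = y ≡ x ⊕ 3 ⊎ x ≡ y ⊕ 3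

  ⊕3≢ : 1 ≤ k → ∀ x → x ⊕ 3 ≢ x
  ⊕3≢ 1≤k x x⊕3≡x = ⊕-≢ x (3<N 1≤k) (s≤s z≤n) (λ ()) (trans x⊕3≡x (sym (⊕-identityʳ x)))

  ThreeApart⇒≢ : 1 ≤ k → ∀ {x y} → ThreeApart x y → x ≢ y
  ThreeApart⇒≢ 1≤k {x} (inj₁ y≡x⊕3) x≡y = ⊕3≢ 1≤k x (trans (sym y≡x⊕3) (sym x≡y))
  ThreeApart⇒≢ 1≤k {y = y} (inj₂ x≡y⊕3) x≡y = ⊕3≢ 1≤k y (trans (sym x≡y⊕3) x≡y)

  exclusive-neg : ∀ {x y r} → Exclusive x y r → Exclusive (neg x) (neg y) (neg r)
  exclusive-neg (exclusive x~r y≁r) = exclusive (neg-~ x~r) (neg-≁ y≁r)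

  exclusive-⊕3 : ∀ x {r} → Exclusive x (x ⊕ 3) r → r ≡ x ⊕ 1
  exclusive-⊕3 x {r} (exclusive x~r x⊕3≁r) =
    from-offset (offset x r) (offset<n x r) (⊕-offset x r) (~-offset x~r)
    where
    from-offset : ∀ c → c < N → x ⊕ c ≡ r → c % 3 ≡ 1 → r ≡ x ⊕ 1
    from-offset 1 _ x⊕1≡r _ = sym x⊕1≡r
    from-offset (suc (suc (suc e))) 3+e<N x⊕c≡r c≡1 = contradiction x⊕3~r x⊕3≁r
      where
      e%3≡1 : e % 3 ≡ 1
      e%3≡1 = trans (sym ([m+n]%n≡m%n e 3)) (trans (cong (_% 3) (+-comm e 3)) c≡1)
      x⊕3~r : x ⊕ 3 ~ r
      x⊕3~r = subst (x ⊕ 3 ~_) (trans (⊕-assoc x 3 e) x⊕c≡r)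
                (Equivalence.from (~-⊕ (x ⊕ 3) (<-trans (m<n+m e {3} (s≤s z≤n)) 3+e<N)) e%3≡1)

  ThreeApart⇒subsingleton : ∀ {x y} → ThreeApart x y → Subsingleton (Exclusive x y)
  ThreeApart⇒subsingleton {x} (inj₁ refl) er es = trans (exclusive-⊕3 x er) (sym (exclusive-⊕3 x es))
  ThreeApart⇒subsingleton {y = y} (inj₂ refl) er es =
    neg-injective (trans (exclusive-⊕3 (neg (y ⊕ 3)) (flip er)) (sym (exclusive-⊕3 (neg (y ⊕ 3)) (flip es))))
    where
    flip : ∀ {r} → Exclusive (y ⊕ 3) y r → Exclusive (neg (y ⊕ 3)) (neg (y ⊕ 3) ⊕ 3) (neg r)
    flip e = subst (λ z → Exclusive (neg (y ⊕ 3)) z _) (sym (neg-⊕ y 3)) (exclusive-neg e)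

  exclusive-above : ∀ x {c d} → d ≤ c → c < N → c % 3 ≡ 1 → d % 3 ≢ 0 → Exclusive x (x ⊕ d) (x ⊕ c)
  exclusive-above x {c} {d} d≤c c<N c≡1 d≢0 =
    exclusive (Equivalence.from (~-⊕ x c<N) c≡1)
      (λ x⊕d~x⊕c → e≢1 (Equivalence.to (~-⊕ (x ⊕ d) e<N) (subst (x ⊕ d ~_) x⊕c≡x⊕d⊕e x⊕d~x⊕c)))
    where
    e = c ∸ d
    e<N : e < N
    e<N = ≤-<-trans (m∸n≤m c d) c<N
    x⊕c≡x⊕d⊕e : x ⊕ c ≡ x ⊕ d ⊕ e
    x⊕c≡x⊕d⊕e = trans (cong (x ⊕_) (sym (m+[n∸m]≡n d≤c))) (sym (⊕-assoc x d e))
    e≢1 : e % 3 ≢ 1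
    e≢1 e≡1 with %3-view d
    ... | inj₁ d≡0        = d≢0 d≡0
    ... | inj₂ (inj₁ d≡1) = contradiction (trans (sym c≡1) (%3-+ {d} {e} (m+[n∸m]≡n d≤c) d≡1 e≡1)) λ ()
    ... | inj₂ (inj₂ d≡2) = contradiction (trans (sym c≡1) (%3-+ {d} {e} (m+[n∸m]≡n d≤c) d≡2 e≡1)) λ ()

  exclusive-below : ∀ x {c d} → c < d → d < N → c % 3 ≡ 1 → d % 3 ≢ 2 → Exclusive x (x ⊕ d) (x ⊕ c)
  exclusive-below x {c} {d} c<d d<N c≡1 d≢2 =
    exclusive (Equivalence.from (~-⊕ x (<-trans c<d d<N)) c≡1)
      (λ x⊕d~x⊕c → e≢1 (Equivalence.to (~-⊕ (x ⊕ d) e<N) (subst (x ⊕ d ~_) x⊕c≡x⊕d⊕e x⊕d~x⊕c)))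
    where
    e = (N ∸ d) + c
    d+e≡c+N : d + e ≡ c + N
    d+e≡c+N = begin
      d + ((N ∸ d) + c) ≡⟨ +-assoc d (N ∸ d) c ⟨
      d + (N ∸ d) + c   ≡⟨ cong (_+ c) (m+[n∸m]≡n (<⇒≤ d<N)) ⟩
      N + c             ≡⟨ +-comm N c ⟩
      c + N             ∎
    e<N : e < N
    e<N = subst (e <_) (m∸n+n≡m (<⇒≤ d<N)) (+-monoʳ-< (N ∸ d) c<d)
    x⊕c≡x⊕d⊕e : x ⊕ c ≡ x ⊕ d ⊕ e
    x⊕c≡x⊕d⊕e = trans (⊕-cong x (trans (sym ([m+n]%n≡m%n c N)) (cong (_% N) (sym d+e≡c+N))))
                      (sym (⊕-assoc x d e))
    c+N≡0 : (c + N) % 3 ≡ 0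
    c+N≡0 = %3-+ {c} {N} refl c≡1 N%3≡2
    e≢1 : e % 3 ≢ 1
    e≢1 e≡1 with %3-view d
    ... | inj₁ d≡0        = contradiction (trans (sym c+N≡0) (%3-+ {d} {e} d+e≡c+N d≡0 e≡1)) λ ()
    ... | inj₂ (inj₁ d≡1) = contradiction (trans (sym c+N≡0) (%3-+ {d} {e} d+e≡c+N d≡1 e≡1)) λ ()
    ... | inj₂ (inj₂ d≡2) = d≢2 d≡2

  two-exclusive⇒¬subsingleton : ∀ x {y c c′} → c < N → c′ < N → c ≢ c′ →
    Exclusive x y (x ⊕ c) → Exclusive x y (x ⊕ c′) → ¬ Subsingleton (Exclusive x y)
  two-exclusive⇒¬subsingleton x c<N c′<N c≢c′ e e′ unique = ⊕-≢ x c<N c′<N c≢c′ (unique e e′)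

  -- x ⊕ c with c ≡ 1 (mod 3) is exclusive unless (c − d) mod N ≡ 1 (mod 3); the residue of d
  -- decides whether the two witnesses are taken below d, above d, or one on each side.
  offset-¬subsingleton : 1 ≤ k → ∀ x {d} → d < N → d ≢ 0 → d ≢ 3 → d + 3 ≢ N →
                         ¬ Subsingleton (Exclusive x (x ⊕ d))
  offset-¬subsingleton 1≤k x {d} d<N d≢0 d≢3 d+3≢N with %3-view d
  ... | inj₁ d≡0 =
    two-exclusive⇒¬subsingleton x (<-trans (<-trans 1<4 4<d) d<N) (<-trans 4<d d<N) (λ ())
      (exclusive-below x (<-trans 1<4 4<d) d<N refl (≢-residue {d} d≡0 λ ()))
      (exclusive-below x 4<d d<N refl (≢-residue {d} d≡0 λ ()))
    where
    1<4 : 1 < 4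
    1<4 = s≤s (s≤s z≤n)
    4<d : 4 < d
    4<d = <-≤-trans (s≤s (s≤s (s≤s (s≤s (s≤s z≤n)))))
                    (+6≤-of-≡%3 {0} (n≢0⇒n>0 d≢0) (sym d≡0) (d≢3 ∘′ sym))
  ... | inj₂ (inj₁ d≡1) = residue-one d d<N d≡1
    where
    residue-one : ∀ d → d < N → d % 3 ≡ 1 → ¬ Subsingleton (Exclusive x (x ⊕ d))
    residue-one 1 1<N _ =
      two-exclusive⇒¬subsingleton x 1<N (5≤N 1≤k) (λ ())
        (exclusive-above x ≤-refl 1<N refl λ ()) (exclusive-above x (s≤s z≤n) (5≤N 1≤k) refl λ ())
    residue-one d@(suc (suc _)) d<N d≡1 =
      two-exclusive⇒¬subsingleton x d<N (<-trans 1<d d<N) (λ ())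
        (exclusive-above x ≤-refl d<N d≡1 (≢-residue {d} d≡1 λ ()))
        (exclusive-below x 1<d d<N refl (≢-residue {d} d≡1 λ ()))
      where
      1<d : 1 < d
      1<d = s≤s (s≤s z≤n)
  ... | inj₂ (inj₂ d≡2) =
    two-exclusive⇒¬subsingleton x d+2<N d+5<N (λ eq → contradiction (+-cancelˡ-≡ d 2 5 eq) λ ())
      (exclusive-above x (m≤m+n d 2) d+2<N (%3-+ {d} {2} refl d≡2 refl) (≢-residue {d} d≡2 λ ()))
      (exclusive-above x (m≤m+n d 5) d+5<N (%3-+ {d} {5} refl d≡2 refl) (≢-residue {d} d≡2 λ ()))
    where
    d+6≤N : d + 6 ≤ N
    d+6≤N = +6≤-of-≡%3 d<N (trans d≡2 (sym N%3≡2)) d+3≢N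
    d+2<N : d + 2 < N
    d+2<N = <-≤-trans (+-monoʳ-< d (s≤s (s≤s (s≤s z≤n)))) d+6≤N
    d+5<N : d + 5 < N
    d+5<N = <-≤-trans (+-monoʳ-< d (n<1+n 5)) d+6≤N

  ¬ThreeApart⇒¬subsingleton : 1 ≤ k → ∀ {x y} → x ≢ y → ¬ ThreeApart x y →
                              ¬ Subsingleton (Exclusive x y)
  ¬ThreeApart⇒¬subsingleton 1≤k {x} {y} x≢y ¬apart =
    subst (λ z → ¬ Subsingleton (Exclusive x z)) (⊕-offset x y)
      (offset-¬subsingleton 1≤k x (offset<n x y) d≢0 d≢3 d+3≢N)
    where
    d = offset x y
    d≢0 : d ≢ 0
    d≢0 d≡0 = x≢y (trans (sym (⊕-identityʳ x)) (trans (cong (x ⊕_) (sym d≡0)) (⊕-offset x y)))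
    d≢3 : d ≢ 3
    d≢3 d≡3 = ¬apart (inj₁ (trans (sym (⊕-offset x y)) (cong (x ⊕_) d≡3)))
    d+3≢N : d + 3 ≢ N
    d+3≢N d+3≡N = ¬apart (inj₂ (sym (begin
      y ⊕ 3       ≡⟨ cong (_⊕ 3) (⊕-offset x y) ⟨
      x ⊕ d ⊕ 3   ≡⟨ ⊕-assoc x d 3 ⟩
      x ⊕ (d + 3) ≡⟨ ⊕-cong x (trans (cong (_% N) d+3≡N) (n%n≡0 N)) ⟩
      x ⊕ 0       ≡⟨ ⊕-identityʳ x ⟩
      x           ∎)))

  ThreeApart-neg : ∀ {x y} → ThreeApart x y → ThreeApart (neg x) (neg y)
  ThreeApart-neg {x} (inj₁ refl) = inj₂ (sym (neg-⊕ x 3))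
  ThreeApart-neg {y = y} (inj₂ refl) = inj₁ (sym (neg-⊕ y 3))

  _~?_ : ∀ x y → Dec (x ~ y)
  x ~? y = Dec.map′ related _~_.cycDist%3≡1 (cycDist N x y % 3 ≟ 1)

  module _ {f : Fin N → Fin N} (f-inj : Injective _≡_ _≡_ f) (f-surj : Surjective _≡_ _≡_ f)
           (f-pres : ∀ {x y} → x ~ y → f x ~ f y) where

    f-reflects : ∀ {x y} → f x ~ f y → x ~ y
    f-reflects = Fin-injective-preserving⇒reflecting _~?_ f-inj f-pres

    preimage : ∀ y → ∃ λ x → f x ≡ y
    preimage y = proj₁ (f-surj y) , proj₂ (f-surj y) refl

    subsingleton-preserved : ∀ {x y} → Subsingleton (Exclusive x y) → Subsingleton (Exclusive (f x) (f y))
    subsingleton-preserved {x} {y} unique {r′} {s′} er es with preimage r′ | preimage s′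
    ... | r , refl | s , refl = cong f (unique (pull er) (pull es))
      where
      pull : ∀ {r} → Exclusive (f x) (f y) (f r) → Exclusive x y r
      pull (exclusive near far) = exclusive (f-reflects near) (far ∘′ f-pres)

    ThreeApart-preserved : 1 ≤ k → ∀ {x y} → ThreeApart x y → ThreeApart (f x) (f y)
    ThreeApart-preserved 1≤k {x} {y} apart with f y ≟ᶠ f x ⊕ 3 | f x ≟ᶠ f y ⊕ 3
    ... | yes fy≡fx⊕3 | _           = inj₁ fy≡fx⊕3
    ... | no _        | yes fx≡fy⊕3 = inj₂ fx≡fy⊕3
    ... | no fy≢fx⊕3  | no fx≢fy⊕3  =
      ⊥-elim (¬ThreeApart⇒¬subsingleton 1≤k (ThreeApart⇒≢ 1≤k apart ∘′ f-inj) ([ fy≢fx⊕3 , fx≢fy⊕3 ])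
               (subsingleton-preserved (ThreeApart⇒subsingleton apart)))

  ThreeApart-preserving⇒≗id : 1 ≤ k → ∀ {g : Fin N → Fin N} → Injective _≡_ _≡_ g →
    (∀ {x y} → ThreeApart x y → ThreeApart (g x) (g y)) →
    g zero ≡ zero → g (zero ⊕ 3) ≡ zero ⊕ 3 → ∀ x → g x ≡ x
  ThreeApart-preserving⇒≗id 1≤k {g} g-inj g-apart g0≡0 g3≡3 x =
    subst (λ z → g z ≡ z) multiple≡x (proj₁ (fixes (suc k * toℕ x)))
    where
    ⊕3⊕3≢ : ∀ y → y ⊕ 3 ⊕ 3 ≢ y
    ⊕3⊕3≢ y eq =
      6%[2+3k]≢0 k 1≤k (⊕-cancelˡ y (trans (sym (⊕-assoc y 3 3)) (trans eq (sym (⊕-identityʳ y)))))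
    step : ∀ y → g y ≡ y → g (y ⊕ 3) ≡ y ⊕ 3 → g (y ⊕ 3 ⊕ 3) ≡ y ⊕ 3 ⊕ 3
    step y gy≡y gy3≡y3 with g-apart {y ⊕ 3} (inj₁ refl)
    ... | inj₁ forward  = trans forward (cong (_⊕ 3) gy3≡y3)
    ... | inj₂ backward = ⊥-elim (⊕3⊕3≢ y (g-inj (trans g[y⊕6]≡y (sym gy≡y))))
      where
      g[y⊕6]≡y : g (y ⊕ 3 ⊕ 3) ≡ y
      g[y⊕6]≡y = ⊕-cancelʳ (<⇒≤ (3<N 1≤k)) (trans (sym backward) gy3≡y3)
    p : ℕ → Fin N
    p j = zero ⊕ 3 * j
    p-suc : ∀ j → p (suc j) ≡ p j ⊕ 3
    p-suc j = trans (cong (zero ⊕_) (trans (*-suc 3 j) (+-comm 3 (3 * j)))) (sym (⊕-assoc zero (3 * j) 3))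
    fixes : ∀ j → g (p j) ≡ p j × g (p (suc j)) ≡ p (suc j)
    fixes zero    = subst (λ z → g z ≡ z) (sym (⊕-identityʳ zero)) g0≡0 , g3≡3
    fixes (suc j) = proj₂ (fixes j) ,
      subst (λ z → g z ≡ z) (sym (trans (p-suc (suc j)) (cong (_⊕ 3) (p-suc j))))
        (step (p j) (proj₁ (fixes j)) (subst (λ z → g z ≡ z) (p-suc j) (proj₂ (fixes j))))
    -- 3 (k + 1) ≡ 1 (mod N)
    multiple≡x : p (suc k * toℕ x) ≡ x
    multiple≡x = begin
      zero ⊕ 3 * (suc k * toℕ x)  ≡⟨ cong (zero ⊕_) (3[1+k]x≡x+x[2+3k] k (toℕ x)) ⟩
      zero ⊕ (toℕ x + toℕ x * N)  ≡⟨ ⊕-cong zero {toℕ x + toℕ x * N} {toℕ x}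
                                            ([m+kn]%n≡m%n (toℕ x) (toℕ x) N) ⟩
      zero ⊕ toℕ x                ≡⟨ zero-⊕ x ⟩
      x                           ∎

  ≗id⊎≗neg : 1 ≤ k → ∀ {f : Fin N → Fin N} → Bijective _≡_ _≡_ f →
    (∀ x y → cycDist N x y % 3 ≡ 1 → cycDist N (f x) (f y) % 3 ≡ 1) →
    f zero ≡ zero → (∀ x → f x ≡ x) ⊎ (∀ x → f x ≡ neg x)
  ≗id⊎≗neg 1≤k {f} (f-inj , f-surj) H f0≡0 = by-image-of-3 (f-apart (inj₁ refl))
    where
    f-apart : ∀ {x y} → ThreeApart x y → ThreeApart (f x) (f y)
    f-apart = ThreeApart-preserved f-inj f-surj (λ (related d) → related (H _ _ d)) 1≤k
    by-image-of-3 : ThreeApart (f zero) (f (zero ⊕ 3)) → (∀ x → f x ≡ x) ⊎ (∀ x → f x ≡ neg x)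
    by-image-of-3 (inj₁ f3≡f0⊕3) =
      inj₁ (ThreeApart-preserving⇒≗id 1≤k f-inj f-apart f0≡0 (trans f3≡f0⊕3 (cong (_⊕ 3) f0≡0)))
    by-image-of-3 (inj₂ f0≡f3⊕3) = inj₂ λ x → trans (sym (neg-involutive (f x))) (cong neg (negf≗id x))
      where
      f3≡neg3 : f (zero ⊕ 3) ≡ neg (zero ⊕ 3)
      f3≡neg3 = ⊕-cancelʳ (<⇒≤ (3<N 1≤k))
                  (trans (sym f0≡f3⊕3) (trans f0≡0 (sym (trans (neg-⊕ zero 3) neg-zero))))
      negf≗id : ∀ x → neg (f x) ≡ x
      negf≗id = ThreeApart-preserving⇒≗id 1≤k (f-inj ∘′ neg-injective) (ThreeApart-neg ∘′ f-apart)
                  (trans (cong neg f0≡0) neg-zero) (trans (cong neg f3≡neg3) (neg-involutive (zero ⊕ 3)))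

theorem4p8 : (k : ℕ) → 1 ≤ k →
    (f : Fin (2 + 3 * k) → Fin (2 + 3 * k)) →
    Bijective _≡_ _≡_ f →
    (∀ x y → cycDist (2 + 3 * k) x y % 3 ≡ 1 →
             cycDist (2 + 3 * k) (f x) (f y) % 3 ≡ 1) →
    f zero ≡ zero →
    Functigraph (Cycle (2 + 3 * k)) f ≅ PrismOf (Cycle (2 + 3 * k))
theorem4p8 k 1≤k f f-bij H f0≡0 =
  [ involutive-automorphism⇒Functigraph≅PrismOf (Cycle N) (λ _ → refl) (λ _ _ adj → adj)
  , involutive-automorphism⇒Functigraph≅PrismOf (Cycle N) neg-involutive
      (λ u v adj → trans (cycDist-neg u v) adj)
  ] (≗id⊎≗neg 1≤k f-bij H f0≡0)
  where open Prism k
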